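{- Let $p$ be a prime number and $n\in\mathbb{N}$, $n\ge 1$. Let $r(p,n)$ denote the number of orbits of the left action of $\mathrm{SL}(2,\mathbb{Z})$ on $(\mathbb{Z}_p\times\mathbb{Z}_p)^n$. Then $$r(p,n)=\frac{p^{2n-1}+p^{n+1}-p^{n-1}+p^2-p-1}{p^2-1}.$$
   Context: Elements of $(\mathbb{Z}_p\times\mathbb{Z}_p)^n$ are viewed as $2\times n$ matrices over $\mathbb{Z}_p$, and $S\in\mathrm{SL}(2,\mathbb{Z})$ acts by left matrix multiplication with the entries of $S$ reduced modulo $p$. -}

module Defs where

open import Data.Nat using (ℕ; NonZero)
open import Data.Integer using (ℤ; +_; _+_; _*_; _-_)
open import Data.Integer.DivMod using (_%ℕ_; n%ℕd<d)
open import Data.Fin using (Fin; toℕ; fromℕ<)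
open import Data.Product using (Σ; ∃; _×_; _,_)
open import Relation.Binary.PropositionalEquality using (_≡_)

Zp : ℕ → Set
Zp p = Fin p

reduce : (p : ℕ) .{{_ : NonZero p}} → ℤ → Zp p
reduce p z = fromℕ< (n%ℕd<d z p)

-- An element of (ℤ_p × ℤ_p)^n, viewed as a 2 × n matrix: column j is the
-- j-th pair (top entry, bottom entry).
Config : ℕ → ℕ → Set
Config p n = Fin n → Zp p × Zp p

record SL2Z : Set where
  constructor mkSL2Z
  field
    a b c d : ℤ
    det≡1  : a * d - b * c ≡ + 1

act : (p : ℕ) .{{_ : NonZero p}} {n : ℕ} → SL2Z → Config p n → Config p n
act p (mkSL2Z a b c d _) M j with M j
... | (x , y) = reduce p (a * + toℕ x + b * + toℕ y)
              , reduce p (c * + toℕ x + d * + toℕ y)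

SameOrbit : (p : ℕ) .{{_ : NonZero p}} {n : ℕ} → Config p n → Config p n → Set
SameOrbit p M N = Σ SL2Z λ S → ∀ j → act p S M j ≡ N j

-- "The action has exactly r orbits": there is a family of r representatives
-- meeting every orbit, no two of which lie in the same orbit.
HasOrbitCount : (p : ℕ) .{{_ : NonZero p}} (n r : ℕ) → Set
HasOrbitCount p n r =
  Σ (Fin r → Config p n) λ rep →
    (∀ (M : Config p n) → ∃ λ i → SameOrbit p (rep i) M)
    × (∀ i k → SameOrbit p (rep i) (rep k) → i ≡ k)

-- Orbits are classified by a normal form read off the columns from left to right.
-- Zero columns are fixed by every matrix. SL(2,ℤ) acts transitively on the nonzero
-- vectors of 𝔽ₚ², so the first nonzero column can be taken to be e₁ = (1,0); what is
-- left to act on the later columns is its stabiliser, the shears (1 β ; 0 1) mod p.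
-- Shears fix every column (x,0), and the first column (x,y) with y ≠ 0 is sheared to
-- (0,y); beyond it only matrices ≡ I mod p remain, so the later columns are free.
-- Counting normal forms gives N₀(k+1) = N₀(k) + N₁(k) and
-- N₁(k+1) = p N₁(k) + (p−1) p²ᵏ, and solving these recurrences gives the formula.
module Submission where

open import Defs
open import Data.Nat using (ℕ; NonZero; _+_; _*_; _∸_; _^_; _≤_)
open import Data.Nat.Primality using (Prime)
open import Data.Product using (Σ; _×_)
open import Relation.Binary.PropositionalEquality using (_≡_)

open import Data.Nat using (zero; suc)
import Data.Nat as ℕ
import Data.Nat.Properties as ℕ
open import Data.Nat.DivMod using (m<n⇒m%n≡m)
open import Data.Nat.Divisibility using (n∣m⇒m%n≡0)
open import Data.Nat.Coprimality using (prime⇒coprime; coprime-Bézout)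
open import Data.Nat.GCD using (module Bézout)
open import Data.Nat.Primality using (¬prime[0]; ¬prime[1])
import Data.Nat.Tactic.RingSolver as ℕ-Solver
open import Data.Integer as ℤ using (ℤ; +_; ∣_∣; _⊖_)
import Data.Integer.Properties as ℤ
open import Data.Integer.Divisibility.Signed
  using (_∣_; divides; ∣⇒∣ᵤ; ∣m∣n⇒∣m+n; ∣m⇒∣-m; ∣m⇒∣m*n; ∣n⇒∣m*n)
open import Data.Integer.DivMod using (_/ℕ_; a≡a%ℕn+[a/ℕn]*n)
open import Data.Integer.Tactic.RingSolver using (solve-∀)
open import Data.Fin as Fin using (Fin; zero; suc; toℕ)
import Data.Fin.Properties as Fin
open import Data.Vec.Functional using (_∷_; tail)
open import Data.Product using (_,_; proj₁; proj₂; ∃)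
import Data.Product.Properties as Product
open import Data.Product.Function.NonDependent.Propositional using (_×-↔_)
open import Data.Sum using (_⊎_; inj₁; inj₂)
open import Data.Sum.Function.Propositional using (_⊎-↔_)
open import Data.Unit using (⊤; tt)
open import Data.Empty using (⊥-elim)
open import Function using (_∘_; _↔_; Inverse)
open import Function.Properties.Inverse using (↔-refl; ↔-trans)
open import Relation.Binary.Bundles using (Setoid)
import Relation.Binary.Reasoning.Setoid
open import Relation.Binary.PropositionalEquality
  using (_≢_; refl; sym; trans; cong; cong₂; subst; module ≡-Reasoning)
open import Relation.Nullary using (¬_; yes; no)

normalForms⇒hasOrbitCount : ∀ {p n r} .{{_ : NonZero p}} {F : Set} (nf : F → Config p n) → Fin r ↔ F →
                (∀ M → ∃ λ u → SameOrbit p (nf u) M) →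
                (∀ u v → SameOrbit p (nf u) (nf v) → u ≡ v) →
                HasOrbitCount p n r
normalForms⇒hasOrbitCount {p} nf enum covers separated = nf ∘ to , reaches , distinct
  where
    open Inverse enum
    reaches : ∀ M → ∃ λ i → SameOrbit p (nf (to i)) M
    reaches M with covers M
    ... | u , orbit = from u , subst (λ w → SameOrbit p (nf w) M) (sym (strictlyInverseˡ u)) orbit
    distinct : ∀ i k → SameOrbit p (nf (to i)) (nf (to k)) → i ≡ k
    distinct i k orbit = begin
      i             ≡⟨ strictlyInverseʳ i ⟨
      from (to i)   ≡⟨ cong from (separated (to i) (to k) orbit) ⟩
      from (to k)   ≡⟨ strictlyInverseʳ k ⟩
      k             ∎
      where open ≡-Reasoning

module Residues (m : ℕ) .{{_ : NonZero m}} where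

  infix 4 _≈_
  record _≈_ (x y : ℤ) : Set where
    constructor mod∣
    field ∣difference : + m ∣ x ℤ.- y
  open _≈_

  ≈-via : ∀ {x y e} → x ℤ.- y ≡ e → + m ∣ e → x ≈ y
  ≈-via eq m∣e = mod∣ (subst (+ m ∣_) (sym eq) m∣e)

  ≈-reflexive : ∀ {x y} → x ≡ y → x ≈ y
  ≈-reflexive {x} refl = mod∣ (divides (+ 0) (ℤ.+-inverseʳ x))

  ≈-refl : ∀ {x} → x ≈ x
  ≈-refl = ≈-reflexive refl

  ≈-sym : ∀ {x y} → x ≈ y → y ≈ x
  ≈-sym {x} {y} (mod∣ x≈y) = ≈-via (difference x y) (∣m⇒∣-m x≈y)
    where difference : ∀ x y → y ℤ.- x ≡ ℤ.- (x ℤ.- y)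
          difference = solve-∀

  ≈-trans : ∀ {x y z} → x ≈ y → y ≈ z → x ≈ z
  ≈-trans {x} {y} {z} (mod∣ x≈y) (mod∣ y≈z) = ≈-via (difference x y z) (∣m∣n⇒∣m+n x≈y y≈z)
    where difference : ∀ x y z → x ℤ.- z ≡ (x ℤ.- y) ℤ.+ (y ℤ.- z)
          difference = solve-∀

  ≈-setoid : Setoid _ _
  ≈-setoid = record
    { Carrier = ℤ ; _≈_ = _≈_
    ; isEquivalence = record { refl = ≈-refl ; sym = ≈-sym ; trans = ≈-trans } }

  module ≈-Reasoning = Relation.Binary.Reasoning.Setoid ≈-setoid

  +-cong : ∀ {x y u v} → x ≈ y → u ≈ v → x ℤ.+ u ≈ y ℤ.+ v
  +-cong {x} {y} {u} {v} (mod∣ x≈y) (mod∣ u≈v) = ≈-via (difference x y u v) (∣m∣n⇒∣m+n x≈y u≈v)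
    where difference : ∀ x y u v → (x ℤ.+ u) ℤ.- (y ℤ.+ v) ≡ (x ℤ.- y) ℤ.+ (u ℤ.- v)
          difference = solve-∀

  *-cong : ∀ {x y u v} → x ≈ y → u ≈ v → x ℤ.* u ≈ y ℤ.* v
  *-cong {x} {y} {u} {v} (mod∣ x≈y) (mod∣ u≈v) =
    ≈-via (difference x y u v) (∣m∣n⇒∣m+n (∣m⇒∣m*n u x≈y) (∣n⇒∣m*n y u≈v))
    where difference : ∀ x y u v → x ℤ.* u ℤ.- y ℤ.* v ≡ (x ℤ.- y) ℤ.* u ℤ.+ y ℤ.* (u ℤ.- v)
          difference = solve-∀

  *-congˡ : ∀ x {u v} → u ≈ v → x ℤ.* u ≈ x ℤ.* v
  *-congˡ x = *-cong (≈-refl {x})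

  *-congʳ : ∀ u {x y} → x ≈ y → x ℤ.* u ≈ y ℤ.* u
  *-congʳ u x≈y = *-cong x≈y (≈-refl {u})

  -‿cong : ∀ {x y} → x ≈ y → ℤ.- x ≈ ℤ.- y
  -‿cong {x} {y} (mod∣ x≈y) = ≈-via (difference x y) (∣m⇒∣-m x≈y)
    where difference : ∀ x y → ℤ.- x ℤ.- ℤ.- y ≡ ℤ.- (x ℤ.- y)
          difference = solve-∀

  modulus≈0 : + m ≈ + 0
  modulus≈0 = mod∣ (divides (+ 1) (difference (+ m)))
    where difference : ∀ m → m ℤ.- + 0 ≡ + 1 ℤ.* m
          difference = solve-∀

  ⟦_⟧ : Fin m → ℤ
  ⟦ u ⟧ = + toℕ u

  ⟦reduce⟧≈ : ∀ z → ⟦ reduce m z ⟧ ≈ z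
  ⟦reduce⟧≈ z = mod∣ (divides (ℤ.- (z /ℕ m)) (begin
    ⟦ reduce m z ⟧ ℤ.- z                     ≡⟨ cong (λ r → + r ℤ.- z) (Fin.toℕ-fromℕ< _) ⟩
    r ℤ.- z                                  ≡⟨ cong (λ w → r ℤ.- w) (a≡a%ℕn+[a/ℕn]*n z m) ⟩
    r ℤ.- (r ℤ.+ (z /ℕ m) ℤ.* + m)           ≡⟨ cancel r (z /ℕ m) (+ m) ⟩
    ℤ.- (z /ℕ m) ℤ.* + m                     ∎))
    where
      open ≡-Reasoning
      r = + (z ℤ.%ℕ m)
      cancel : ∀ r k m → r ℤ.- (r ℤ.+ k ℤ.* m) ≡ ℤ.- k ℤ.* m
      cancel = solve-∀

  ⟦⟧-injective : ∀ {u v} → ⟦ u ⟧ ≈ ⟦ v ⟧ → u ≡ v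
  ⟦⟧-injective {u} {v} u≈v = Fin.toℕ-injective (ℤ.+-injective
    (ℤ.i-j≡0⇒i≡j ⟦ u ⟧ ⟦ v ⟧ (ℤ.∣i∣≡0⇒i≡0 distance≡0)))
    where
      distance = ∣ ⟦ u ⟧ ℤ.- ⟦ v ⟧ ∣
      distance<m : distance ℕ.< m
      distance<m = begin-strict
        distance                  ≡⟨ cong ∣_∣ (ℤ.[+m]-[+n]≡m⊖n (toℕ u) (toℕ v)) ⟩
        ∣ toℕ u ⊖ toℕ v ∣         ≤⟨ ℤ.∣m⊝n∣≤m⊔n (toℕ u) (toℕ v) ⟩
        toℕ u ℕ.⊔ toℕ v           <⟨ ℕ.⊔-lub (Fin.toℕ<n u) (Fin.toℕ<n v) ⟩
        m                         ∎
        where open ℕ.≤-Reasoning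
      distance≡0 : distance ≡ 0
      distance≡0 = begin
        distance           ≡⟨ sym (m<n⇒m%n≡m distance<m) ⟩
        distance ℕ.% m     ≡⟨ n∣m⇒m%n≡0 distance m (∣⇒∣ᵤ (∣difference u≈v)) ⟩
        0                  ∎
        where open ≡-Reasoning

  reduce-≈ : ∀ {z u} → z ≈ ⟦ u ⟧ → reduce m z ≡ u
  reduce-≈ {z} z≈u = ⟦⟧-injective (≈-trans (⟦reduce⟧≈ z) z≈u)

  ≈-reduce : ∀ {z u} → reduce m z ≡ u → z ≈ ⟦ u ⟧
  ≈-reduce {z} refl = ≈-sym (⟦reduce⟧≈ z)

module ColumnAction (p : ℕ) .{{_ : NonZero p}} where

  open Residues p

  Col : Set
  Col = Zp p × Zp p

  row : ℤ → ℤ → Col → ℤ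
  row a b (x , y) = a ℤ.* ⟦ x ⟧ ℤ.+ b ℤ.* ⟦ y ⟧

  row-cong : ∀ v {a a′ b b′} → a ≈ a′ → b ≈ b′ → row a b v ≈ row a′ b′ v
  row-cong (x , y) a≈a′ b≈b′ = +-cong (*-congʳ ⟦ x ⟧ a≈a′) (*-congʳ ⟦ y ⟧ b≈b′)

  infixr 5 _⊙_
  _⊙_ : SL2Z → Col → Col
  mkSL2Z a b c d _ ⊙ v = reduce p (row a b v) , reduce p (row c d v)

  ≈⇒⊙≡ : ∀ S v {w} → let open SL2Z S in
         row a b v ≈ ⟦ proj₁ w ⟧ → row c d v ≈ ⟦ proj₂ w ⟧ → S ⊙ v ≡ w
  ≈⇒⊙≡ S v first second = cong₂ _,_ (reduce-≈ first) (reduce-≈ second)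

  ⊙≡⇒≈ : ∀ S v {w} → let open SL2Z S in
         S ⊙ v ≡ w → (row a b v ≈ ⟦ proj₁ w ⟧) × (row c d v ≈ ⟦ proj₂ w ⟧)
  ⊙≡⇒≈ S v refl = ≈-reduce refl , ≈-reduce refl

  I : SL2Z
  I = mkSL2Z (+ 1) (+ 0) (+ 0) (+ 1) refl

  infixl 7 _∙_
  _∙_ : SL2Z → SL2Z → SL2Z
  mkSL2Z a b c d ad-bc≡1 ∙ mkSL2Z a′ b′ c′ d′ a′d′-b′c′≡1 =
    mkSL2Z (a ℤ.* a′ ℤ.+ b ℤ.* c′) (a ℤ.* b′ ℤ.+ b ℤ.* d′)
           (c ℤ.* a′ ℤ.+ d ℤ.* c′) (c ℤ.* b′ ℤ.+ d ℤ.* d′)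
           (trans (det-multiplicative a b c d a′ b′ c′ d′) (cong₂ ℤ._*_ ad-bc≡1 a′d′-b′c′≡1))
    where
      det-multiplicative : ∀ a b c d a′ b′ c′ d′ →
        (a ℤ.* a′ ℤ.+ b ℤ.* c′) ℤ.* (c ℤ.* b′ ℤ.+ d ℤ.* d′) ℤ.- (a ℤ.* b′ ℤ.+ b ℤ.* d′) ℤ.* (c ℤ.* a′ ℤ.+ d ℤ.* c′)
        ≡ (a ℤ.* d ℤ.- b ℤ.* c) ℤ.* (a′ ℤ.* d′ ℤ.- b′ ℤ.* c′)
      det-multiplicative = solve-∀

  infix 8 _⁻¹
  _⁻¹ : SL2Z → SL2Z
  mkSL2Z a b c d ad-bc≡1 ⁻¹ = mkSL2Z d (ℤ.- b) (ℤ.- c) a (trans (adjugate-det a b c d) ad-bc≡1)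
    where adjugate-det : ∀ a b c d → d ℤ.* a ℤ.- ℤ.- b ℤ.* ℤ.- c ≡ a ℤ.* d ℤ.- b ℤ.* c
          adjugate-det = solve-∀

  ⊙-∙ : ∀ S T v → (S ∙ T) ⊙ v ≡ S ⊙ T ⊙ v
  ⊙-∙ S@(mkSL2Z a b c d _) T@(mkSL2Z a′ b′ c′ d′ _) v@(x , y) =
    ≈⇒⊙≡ (S ∙ T) v (composite a b) (composite c d)
    where
      expand : ∀ a b a′ b′ c′ d′ X Y →
        (a ℤ.* a′ ℤ.+ b ℤ.* c′) ℤ.* X ℤ.+ (a ℤ.* b′ ℤ.+ b ℤ.* d′) ℤ.* Y
        ≡ a ℤ.* (a′ ℤ.* X ℤ.+ b′ ℤ.* Y) ℤ.+ b ℤ.* (c′ ℤ.* X ℤ.+ d′ ℤ.* Y)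
      expand = solve-∀
      open ≈-Reasoning
      composite : ∀ a b → row (a ℤ.* a′ ℤ.+ b ℤ.* c′) (a ℤ.* b′ ℤ.+ b ℤ.* d′) v
                          ≈ ⟦ reduce p (row a b (T ⊙ v)) ⟧
      composite a b = begin
        row (a ℤ.* a′ ℤ.+ b ℤ.* c′) (a ℤ.* b′ ℤ.+ b ℤ.* d′) v
          ≡⟨ expand a b a′ b′ c′ d′ ⟦ x ⟧ ⟦ y ⟧ ⟩
        a ℤ.* row a′ b′ v ℤ.+ b ℤ.* row c′ d′ v
          ≈⟨ +-cong (*-congˡ a (≈-sym (⟦reduce⟧≈ (row a′ b′ v))))
                    (*-congˡ b (≈-sym (⟦reduce⟧≈ (row c′ d′ v)))) ⟩
        row a b (T ⊙ v)
          ≈⟨ ≈-sym (⟦reduce⟧≈ (row a b (T ⊙ v))) ⟩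
        ⟦ reduce p (row a b (T ⊙ v)) ⟧ ∎

  ⊙-identity : ∀ S v → let open SL2Z S in
               a ≈ + 1 → b ≈ + 0 → c ≈ + 0 → d ≈ + 1 → S ⊙ v ≡ v
  ⊙-identity S v@(x , y) a≈1 b≈0 c≈0 d≈1 = ≈⇒⊙≡ S v
    (≈-trans (row-cong v a≈1 b≈0) (≈-reflexive (first ⟦ x ⟧ ⟦ y ⟧)))
    (≈-trans (row-cong v c≈0 d≈1) (≈-reflexive (second ⟦ x ⟧ ⟦ y ⟧)))
    where
      first : ∀ X Y → + 1 ℤ.* X ℤ.+ + 0 ℤ.* Y ≡ X
      first = solve-∀
      second : ∀ X Y → + 0 ℤ.* X ℤ.+ + 1 ℤ.* Y ≡ Y
      second = solve-∀

  ⊙-⁻¹ : ∀ S v → S ⊙ S ⁻¹ ⊙ v ≡ v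
  ⊙-⁻¹ S@(mkSL2Z a b c d ad-bc≡1) v = trans (sym (⊙-∙ S (S ⁻¹) v))
    (⊙-identity (S ∙ S ⁻¹) v (≈-reflexive (trans (entry₁₁ a b c d) ad-bc≡1)) (≈-reflexive (entry₁₂ a b))
                             (≈-reflexive (entry₂₁ c d)) (≈-reflexive (trans (entry₂₂ a b c d) ad-bc≡1)))
    where
      entry₁₁ : ∀ a b c d → a ℤ.* d ℤ.+ b ℤ.* ℤ.- c ≡ a ℤ.* d ℤ.- b ℤ.* c
      entry₁₁ = solve-∀
      entry₁₂ : ∀ a b → a ℤ.* ℤ.- b ℤ.+ b ℤ.* a ≡ + 0
      entry₁₂ = solve-∀
      entry₂₁ : ∀ c d → c ℤ.* d ℤ.+ d ℤ.* ℤ.- c ≡ + 0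
      entry₂₁ = solve-∀
      entry₂₂ : ∀ a b c d → c ℤ.* ℤ.- b ℤ.+ d ℤ.* a ≡ a ℤ.* d ℤ.- b ℤ.* c
      entry₂₂ = solve-∀

module NormalForms (q : ℕ) where

  p : ℕ
  p = suc q

  -- Normal forms of k columns under SL(2,ℤ) (NF₀), under the stabiliser of e₁ (NF₁) and
  -- under the matrices acting trivially (NF₂); an i : Fin q stands for the nonzero residue suc i.
  NF₂ : ℕ → Set
  NF₂ zero    = ⊤
  NF₂ (suc k) = (Fin p × Fin p) × NF₂ k

  NF₁ : ℕ → Set
  NF₁ zero    = ⊤
  NF₁ (suc k) = (Fin p × NF₁ k) ⊎ (Fin q × NF₂ k)

  NF₀ : ℕ → Set
  NF₀ zero    = ⊤
  NF₀ (suc k) = NF₀ k ⊎ NF₁ k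

  #NF₁ : ℕ → ℕ
  #NF₁ zero    = 1
  #NF₁ (suc k) = p * #NF₁ k + q * (p * p) ^ k

  #NF₀ : ℕ → ℕ
  #NF₀ zero    = 1
  #NF₀ (suc k) = #NF₀ k + #NF₁ k

  enum₂ : ∀ k → Fin ((p * p) ^ k) ↔ NF₂ k
  enum₂ zero    = Fin.1↔⊤
  enum₂ (suc k) = ↔-trans Fin.*↔× (Fin.*↔× ×-↔ enum₂ k)

  enum₁ : ∀ k → Fin (#NF₁ k) ↔ NF₁ k
  enum₁ zero    = Fin.1↔⊤
  enum₁ (suc k) = ↔-trans Fin.+↔⊎
    (↔-trans Fin.*↔× (↔-refl ×-↔ enum₁ k) ⊎-↔ ↔-trans Fin.*↔× (↔-refl ×-↔ enum₂ k))

  enum₀ : ∀ k → Fin (#NF₀ k) ↔ NF₀ k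
  enum₀ zero    = Fin.1↔⊤
  enum₀ (suc k) = ↔-trans Fin.+↔⊎ (enum₀ k ⊎-↔ enum₁ k)

  p²∸1≡q*[2+q] : p ^ 2 ∸ 1 ≡ q * (2 + q)
  p²∸1≡q*[2+q] = cong (_∸ 1) (square q)
    where square : ∀ q → let p = 1 + q in p * (p * 1) ≡ 1 + q * (2 + q)
          square = ℕ-Solver.solve-∀

  p*#NF₁ : ∀ k → p * #NF₁ k + p ^ k ≡ (p * p) ^ k + p * p ^ k
  p*#NF₁ zero    = ℕ.+-comm (p * 1) 1
  p*#NF₁ (suc k) = begin
    p * (p * r + q * y) + p * x  ≡⟨ regroup p q r x y ⟩
    p * (p * r + x) + p * q * y  ≡⟨ cong (λ w → p * w + p * q * y) (p*#NF₁ k) ⟩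
    p * (y + p * x) + p * q * y  ≡⟨ collect q x y ⟩
    (p * p) * y + p * (p * x)    ∎
    where
      open ≡-Reasoning
      r = #NF₁ k
      x = p ^ k
      y = (p * p) ^ k
      regroup : ∀ p q r x y → p * (p * r + q * y) + p * x ≡ p * (p * r + x) + p * q * y
      regroup = ℕ-Solver.solve-∀
      collect : ∀ q x y → let p = 1 + q in
                p * (y + p * x) + p * q * y ≡ (p * p) * y + p * (p * x)
      collect = ℕ-Solver.solve-∀

  -- The term p² pᵏ is added to both sides so that both induction hypotheses
  -- can be substituted without any subtraction.
  p*#NF₀ : ∀ k → p * (#NF₀ k * (q * (2 + q))) + p ^ k + p * p + p
               ≡ (p * p) ^ k + p * p * p ^ k + p * p * p
  p*#NF₀ zero = base q
    where base : ∀ q → let p = 1 + q in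
                 p * (1 * (q * (2 + q))) + 1 + p * p + p ≡ 1 + p * p * 1 + p * p * p
          base = ℕ-Solver.solve-∀
  p*#NF₀ (suc k) = ℕ.+-cancelʳ-≡ (p * p * x) _ _ (begin
    p * ((r₀ + r₁) * D) + p * x + p * p + p + p * p * x
      ≡⟨ regroup q r₀ r₁ x ⟩
    (p * (r₀ * D) + x + p * p + p) + D * (p * r₁ + x) + p * x
      ≡⟨ cong₂ (λ u v → u + D * v + p * x) (p*#NF₀ k) (p*#NF₁ k) ⟩
    (y + p * p * x + p * p * p) + D * (y + p * x) + p * x
      ≡⟨ collect q x y ⟩
    (p * p) * y + p * p * (p * x) + p * p * p + p * p * x ∎)
    where
      open ≡-Reasoning
      D = q * (2 + q)
      r₀ = #NF₀ k
      r₁ = #NF₁ k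
      x = p ^ k
      y = (p * p) ^ k
      regroup : ∀ q r₀ r₁ x → let p = 1 + q; D = q * (2 + q) in
        p * ((r₀ + r₁) * D) + p * x + p * p + p + p * p * x
        ≡ (p * (r₀ * D) + x + p * p + p) + D * (p * r₁ + x) + p * x
      regroup = ℕ-Solver.solve-∀
      collect : ∀ q x y → let p = 1 + q; D = q * (2 + q) in
        (y + p * p * x + p * p * p) + D * (y + p * x) + p * x
        ≡ (p * p) * y + p * p * (p * x) + p * p * p + p * p * x
      collect = ℕ-Solver.solve-∀

  [p*p]^k≡p^[2*k] : ∀ k → (p * p) ^ k ≡ p ^ (2 * k)
  [p*p]^k≡p^[2*k] k = trans (cong (λ n → (p * n) ^ k) (sym (ℕ.*-identityʳ p))) (ℕ.^-*-assoc p 2 k)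

  #NF₀-formula : ∀ m → #NF₀ (suc m) * (p ^ 2 ∸ 1) + p ^ (suc m ∸ 1) + p + 1
                       ≡ p ^ (2 * suc m ∸ 1) + p ^ (suc m + 1) + p ^ 2
  #NF₀-formula m = ℕ.*-cancelˡ-≡ _ _ p (begin
    p * (r * (p ^ 2 ∸ 1) + x + p + 1)
      ≡⟨ cong (λ D → p * (r * D + x + p + 1)) p²∸1≡q*[2+q] ⟩
    p * (r * D + x + p + 1)
      ≡⟨ distribute p r D x ⟩
    p * (r * D) + p * x + p * p + p
      ≡⟨ p*#NF₀ (suc m) ⟩
    (p * p) ^ suc m + p * p * (p * x) + p * p * p
      ≡⟨ cong (λ v → v + p * p * (p * x) + p * p * p) ([p*p]^k≡p^[2*k] (suc m)) ⟩
    p * u + p * p * (p * x) + p * p * p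
      ≡⟨ factor p u x ⟩
    p * (u + p * x * (p * 1) + p ^ 2)
      ≡⟨ cong (λ v → p * (u + v + p ^ 2)) (ℕ.^-distribˡ-+-* p (suc m) 1) ⟨
    p * (u + p ^ (suc m + 1) + p ^ 2) ∎)
    where
      open ≡-Reasoning
      D = q * (2 + q)
      r = #NF₀ (suc m)
      x = p ^ m
      u = p ^ (2 * suc m ∸ 1)
      distribute : ∀ p r D x → p * (r * D + x + p + 1) ≡ p * (r * D) + p * x + p * p + p
      distribute = ℕ-Solver.solve-∀
      factor : ∀ p u x → p * u + p * p * (p * x) + p * p * p ≡ p * (u + p * x * (p * 1) + p * (p * 1))
      factor = ℕ-Solver.solve-∀

module Orbits (q′ : ℕ) (p-prime : Prime (2 + q′)) where

  open NormalForms (suc q′)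
  open Residues p
  open ColumnAction p

  𝟎 e₁ : Col
  𝟎  = zero , zero
  e₁ = suc zero , zero

  1≉0 : ¬ (+ 1 ≈ + 0)
  1≉0 1≈0 = Fin.0≢1+n (sym (⟦⟧-injective {suc zero} {zero} 1≈0))

  det-cong : ∀ b d {a a′ c c′} → a ≈ a′ → c ≈ c′ → a ℤ.* d ℤ.- b ℤ.* c ≈ a′ ℤ.* d ℤ.- b ℤ.* c′
  det-cong b d a≈a′ c≈c′ = +-cong (*-congʳ d a≈a′) (-‿cong (*-congˡ b c≈c′))

  ℕ-Bézout⇒ℤ : ∀ a b c d → 1 + a * b ≡ c * d → + 1 ℤ.+ + a ℤ.* + b ≡ + c ℤ.* + d
  ℕ-Bézout⇒ℤ a b c d eq = begin
    + 1 ℤ.+ + a ℤ.* + b   ≡⟨ cong (λ n → + 1 ℤ.+ n) (ℤ.pos-* a b) ⟨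
    + 1 ℤ.+ + (a * b)     ≡⟨ ℤ.pos-+ 1 (a * b) ⟨
    + (1 + a * b)         ≡⟨ cong +_ eq ⟩
    + (c * d)             ≡⟨ ℤ.pos-* c d ⟩
    + c ℤ.* + d           ∎
    where open ≡-Reasoning

  invertible : ∀ (i : Fin (suc q′)) → ∃ λ t → t ℤ.* ⟦ suc i ⟧ ≈ + 1
  invertible i with coprime-Bézout (prime⇒coprime p-prime (Fin.toℕ<n (suc i)))
  ... | Bézout.+- x y eq = ℤ.- + y , mod∣ (divides (ℤ.- + x) (begin
    ℤ.- + y ℤ.* ⟦ suc i ⟧ ℤ.- + 1         ≡⟨ negate (+ y) ⟦ suc i ⟧ ⟩
    ℤ.- (+ 1 ℤ.+ + y ℤ.* ⟦ suc i ⟧)       ≡⟨ cong ℤ.-_ (ℕ-Bézout⇒ℤ y (toℕ (suc i)) x p eq) ⟩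
    ℤ.- (+ x ℤ.* + p)                     ≡⟨ ℤ.neg-distribˡ-* (+ x) (+ p) ⟩
    ℤ.- + x ℤ.* + p                       ∎))
    where
      open ≡-Reasoning
      negate : ∀ y n → ℤ.- y ℤ.* n ℤ.- + 1 ≡ ℤ.- (+ 1 ℤ.+ y ℤ.* n)
      negate = solve-∀
  ... | Bézout.-+ x y eq = + y , mod∣ (divides (+ x) (begin
    + y ℤ.* ⟦ suc i ⟧ ℤ.- + 1             ≡⟨ cong (λ n → n ℤ.- + 1) (ℕ-Bézout⇒ℤ x p y (toℕ (suc i)) eq) ⟨
    + 1 ℤ.+ + x ℤ.* + p ℤ.- + 1           ≡⟨ cancel (+ x ℤ.* + p) ⟩
    + x ℤ.* + p                           ∎))
    where
      open ≡-Reasoning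
      cancel : ∀ n → + 1 ℤ.+ n ℤ.- + 1 ≡ n
      cancel = solve-∀

  cancel-nonzero : ∀ (i : Fin (suc q′)) {b} → b ℤ.* ⟦ suc i ⟧ ≈ + 0 → b ≈ + 0
  cancel-nonzero i {b} by≈0 = begin
    b                       ≡⟨ ℤ.*-identityʳ b ⟨
    b ℤ.* + 1               ≈⟨ *-congˡ b (≈-sym ty≈1) ⟩
    b ℤ.* (t ℤ.* y)         ≡⟨ swap b t y ⟩
    t ℤ.* (b ℤ.* y)         ≈⟨ *-congˡ t by≈0 ⟩
    t ℤ.* + 0               ≡⟨ ℤ.*-zeroʳ t ⟩
    + 0                     ∎
    where
      open ≈-Reasoning
      y = ⟦ suc i ⟧
      t = proj₁ (invertible i)
      ty≈1 = proj₂ (invertible i)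
      swap : ∀ b t y → b ℤ.* (t ℤ.* y) ≡ t ℤ.* (b ℤ.* y)
      swap = solve-∀

  row-𝟎 : ∀ a b → row a b 𝟎 ≡ + 0
  row-𝟎 = unfolded
    where unfolded : ∀ a b → a ℤ.* + 0 ℤ.+ b ℤ.* + 0 ≡ + 0
          unfolded = solve-∀

  row-e₁ : ∀ a b → row a b e₁ ≡ a
  row-e₁ = unfolded
    where unfolded : ∀ a b → a ℤ.* + 1 ℤ.+ b ℤ.* + 0 ≡ a
          unfolded = solve-∀

  ⊙-zero : ∀ S → S ⊙ 𝟎 ≡ 𝟎
  ⊙-zero S = ≈⇒⊙≡ S 𝟎 (≈-reflexive (row-𝟎 a b)) (≈-reflexive (row-𝟎 c d))
    where open SL2Z S

  ⊙e₁≡ : ∀ S {w} → let open SL2Z S in a ≈ ⟦ proj₁ w ⟧ → c ≈ ⟦ proj₂ w ⟧ → S ⊙ e₁ ≡ w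
  ⊙e₁≡ S a≈ c≈ = ≈⇒⊙≡ S e₁ (≈-trans (≈-reflexive (row-e₁ a b)) a≈) (≈-trans (≈-reflexive (row-e₁ c d)) c≈)
    where open SL2Z S

  ⊙e₁≡⇒ : ∀ S {w} → let open SL2Z S in S ⊙ e₁ ≡ w → (a ≈ ⟦ proj₁ w ⟧) × (c ≈ ⟦ proj₂ w ⟧)
  ⊙e₁≡⇒ S eq = ≈-trans (≈-reflexive (sym (row-e₁ a b))) (proj₁ (⊙≡⇒≈ S e₁ eq))
             , ≈-trans (≈-reflexive (sym (row-e₁ c d))) (proj₂ (⊙≡⇒≈ S e₁ eq))
    where open SL2Z S

  first-column-nonzero : ∀ S → S ⊙ e₁ ≢ 𝟎
  first-column-nonzero S@(mkSL2Z a b c d ad-bc≡1) S⊙e₁≡𝟎 = 1≉0 (begin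
    + 1                         ≡⟨ ad-bc≡1 ⟨
    a ℤ.* d ℤ.- b ℤ.* c         ≈⟨ det-cong b d (proj₁ (⊙e₁≡⇒ S S⊙e₁≡𝟎)) (proj₂ (⊙e₁≡⇒ S S⊙e₁≡𝟎)) ⟩
    + 0 ℤ.* d ℤ.- b ℤ.* + 0     ≡⟨ det-vanishes b d ⟩
    + 0                         ∎)
    where
      open ≈-Reasoning
      det-vanishes : ∀ b d → + 0 ℤ.* d ℤ.- b ℤ.* + 0 ≡ + 0
      det-vanishes = solve-∀

  e₁-orbit : ∀ v → v ≢ 𝟎 → Σ SL2Z λ S → S ⊙ e₁ ≡ v
  e₁-orbit (zero , zero) v≢𝟎 = ⊥-elim (v≢𝟎 refl)
  e₁-orbit (x , suc i) _ = S , ⊙e₁≡ S a≈x ≈-refl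
    where
      open ≈-Reasoning
      y = ⟦ suc i ⟧
      t = proj₁ (invertible i)
      β = (⟦ x ⟧ ℤ.- + 1) ℤ.* t
      det : ∀ β y → (+ 1 ℤ.+ β ℤ.* y) ℤ.* + 1 ℤ.- β ℤ.* y ≡ + 1
      det = solve-∀
      S = mkSL2Z (+ 1 ℤ.+ β ℤ.* y) β y (+ 1) (det β y)
      reassociate : ∀ X t y → + 1 ℤ.+ (X ℤ.- + 1) ℤ.* t ℤ.* y ≡ + 1 ℤ.+ (X ℤ.- + 1) ℤ.* (t ℤ.* y)
      reassociate = solve-∀
      simplify : ∀ X → + 1 ℤ.+ (X ℤ.- + 1) ℤ.* + 1 ≡ X
      simplify = solve-∀
      a≈x : + 1 ℤ.+ β ℤ.* y ≈ ⟦ x ⟧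
      a≈x = begin
        + 1 ℤ.+ β ℤ.* y                          ≡⟨ reassociate ⟦ x ⟧ t y ⟩
        + 1 ℤ.+ (⟦ x ⟧ ℤ.- + 1) ℤ.* (t ℤ.* y)    ≈⟨ +-cong (≈-refl {+ 1}) (*-congˡ (⟦ x ⟧ ℤ.- + 1) (proj₂ (invertible i))) ⟩
        + 1 ℤ.+ (⟦ x ⟧ ℤ.- + 1) ℤ.* + 1          ≡⟨ simplify ⟦ x ⟧ ⟩
        ⟦ x ⟧                                    ∎
  -- t x = 1 + k p exactly, so (x k ; p t) lies in SL(2,ℤ) and has first column (x , p) ≡ (x , 0).
  e₁-orbit (suc i , zero) _ with invertible i
  ... | t , mod∣ (divides k tx-1≡kp) = S , ⊙e₁≡ S ≈-refl modulus≈0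
    where
      open ≡-Reasoning
      x = ⟦ suc i ⟧
      expand : ∀ x t k p → x ℤ.* t ℤ.- k ℤ.* p ≡ (t ℤ.* x ℤ.- + 1) ℤ.+ + 1 ℤ.- k ℤ.* p
      expand = solve-∀
      cancel : ∀ k p → k ℤ.* p ℤ.+ + 1 ℤ.- k ℤ.* p ≡ + 1
      cancel = solve-∀
      det : x ℤ.* t ℤ.- k ℤ.* + p ≡ + 1
      det = begin
        x ℤ.* t ℤ.- k ℤ.* + p                         ≡⟨ expand x t k (+ p) ⟩
        (t ℤ.* x ℤ.- + 1) ℤ.+ + 1 ℤ.- k ℤ.* + p       ≡⟨ cong (λ e → e ℤ.+ + 1 ℤ.- k ℤ.* + p) tx-1≡kp ⟩
        k ℤ.* + p ℤ.+ + 1 ℤ.- k ℤ.* + p               ≡⟨ cancel k (+ p) ⟩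
        + 1                                           ∎
      S = mkSL2Z x k (+ p) t det

  module Stabilizer (S : SL2Z) (S⊙e₁≡e₁ : S ⊙ e₁ ≡ e₁) where

    open SL2Z S public

    a≈1 : a ≈ + 1
    a≈1 = proj₁ (⊙e₁≡⇒ S S⊙e₁≡e₁)

    c≈0 : c ≈ + 0
    c≈0 = proj₂ (⊙e₁≡⇒ S S⊙e₁≡e₁)

    d≈1 : d ≈ + 1
    d≈1 = begin
      d                           ≡⟨ det-reduces b d ⟩
      + 1 ℤ.* d ℤ.- b ℤ.* + 0     ≈⟨ det-cong b d a≈1 c≈0 ⟨
      a ℤ.* d ℤ.- b ℤ.* c         ≡⟨ det≡1 ⟩
      + 1                         ∎
      where
        open ≈-Reasoning
        det-reduces : ∀ b d → d ≡ + 1 ℤ.* d ℤ.- b ℤ.* + 0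
        det-reduces = solve-∀

    fixes-axis : ∀ x → S ⊙ (x , zero) ≡ (x , zero)
    fixes-axis x = ≈⇒⊙≡ S (x , zero)
      (≈-trans (row-cong (x , zero) a≈1 (≈-refl {b})) (≈-reflexive (first b ⟦ x ⟧)))
      (≈-trans (row-cong (x , zero) c≈0 (≈-refl {d})) (≈-reflexive (second d ⟦ x ⟧)))
      where
        first : ∀ b X → + 1 ℤ.* X ℤ.+ b ℤ.* + 0 ≡ X
        first = solve-∀
        second : ∀ d X → + 0 ℤ.* X ℤ.+ d ℤ.* + 0 ≡ + 0
        second = solve-∀

    fixes-second : ∀ y → proj₂ (S ⊙ (zero , y)) ≡ y
    fixes-second y = reduce-≈ (≈-trans (row-cong (zero , y) (≈-refl {c}) d≈1) (≈-reflexive (second c ⟦ y ⟧)))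
      where second : ∀ c Y → c ℤ.* + 0 ℤ.+ + 1 ℤ.* Y ≡ Y
            second = solve-∀

    trivial : b ≈ + 0 → ∀ v → S ⊙ v ≡ v
    trivial b≈0 v = ⊙-identity S v a≈1 b≈0 c≈0 d≈1

  U : ℤ → SL2Z
  U β = mkSL2Z (+ 1) β (+ 0) (+ 1) (det β)
    where det : ∀ β → + 1 ℤ.* + 1 ℤ.- β ℤ.* + 0 ≡ + 1
          det = solve-∀

  U-fixes-e₁ : ∀ β → U β ⊙ e₁ ≡ e₁
  U-fixes-e₁ β = ⊙e₁≡ (U β) ≈-refl ≈-refl

  U-shear : ∀ β x y → β ℤ.* ⟦ y ⟧ ≈ ⟦ x ⟧ → U β ⊙ (zero , y) ≡ (x , y)
  U-shear β x y βy≈x = ≈⇒⊙≡ (U β) (zero , y) (≈-trans (≈-reflexive (first β ⟦ y ⟧)) βy≈x)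
                                              (≈-reflexive (second ⟦ y ⟧))
    where first : ∀ β Y → + 1 ℤ.* + 0 ℤ.+ β ℤ.* Y ≡ β ℤ.* Y
          first = solve-∀
          second : ∀ Y → + 0 ℤ.* + 0 ℤ.+ + 1 ℤ.* Y ≡ Y
          second = solve-∀

  nf₂ : ∀ {k} → NF₂ k → Config p k
  nf₂ {zero}  tt      = λ ()
  nf₂ {suc k} (v , u) = v ∷ nf₂ u

  nf₁ : ∀ {k} → NF₁ k → Config p k
  nf₁ {zero}  tt             = λ ()
  nf₁ {suc k} (inj₁ (x , u)) = (x , zero) ∷ nf₁ u
  nf₁ {suc k} (inj₂ (i , u)) = (zero , suc i) ∷ nf₂ u

  nf₀ : ∀ {k} → NF₀ k → Config p k
  nf₀ {zero}  tt       = λ ()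
  nf₀ {suc k} (inj₁ u) = 𝟎 ∷ nf₀ u
  nf₀ {suc k} (inj₂ u) = e₁ ∷ nf₁ u

  toNF₂ : ∀ {k} → Config p k → NF₂ k
  toNF₂ {zero}  M = tt
  toNF₂ {suc k} M = M zero , toNF₂ (tail M)

  nf₂-toNF₂ : ∀ {k} (M : Config p k) j → nf₂ (toNF₂ M) j ≡ M j
  nf₂-toNF₂ M zero    = refl
  nf₂-toNF₂ M (suc j) = nf₂-toNF₂ (tail M) j

  nf₂-injective : ∀ {k} (u v : NF₂ k) → (∀ j → nf₂ u j ≡ nf₂ v j) → u ≡ v
  nf₂-injective {zero}  tt      tt      _  = refl
  nf₂-injective {suc k} (_ , u) (_ , v) eq = cong₂ _,_ (eq zero) (nf₂-injective u v (eq ∘ suc))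

  nf₁-covers : ∀ {k} (M : Config p k) → Σ (NF₁ k) λ u → Σ ℤ λ β → ∀ j → U β ⊙ nf₁ u j ≡ M j
  nf₁-covers {zero}  M = tt , + 0 , λ ()
  nf₁-covers {suc k} M with M zero in M₀≡
  ... | x , zero with nf₁-covers (tail M)
  ...   | u , β , h = inj₁ (x , u) , β , λ where
            zero    → trans (Stabilizer.fixes-axis (U β) (U-fixes-e₁ β) x) (sym M₀≡)
            (suc j) → h j
  nf₁-covers {suc k} M | x , suc i = inj₂ (i , toNF₂ (λ j → U β ⁻¹ ⊙ M (suc j))) , β , λ where
      zero    → trans (U-shear β x (suc i) βy≈x) (sym M₀≡)
      (suc j) → trans (cong (U β ⊙_) (nf₂-toNF₂ _ j)) (⊙-⁻¹ (U β) (M (suc j)))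
    where
      open ≈-Reasoning
      y = ⟦ suc i ⟧
      t = proj₁ (invertible i)
      β = ⟦ x ⟧ ℤ.* t
      βy≈x : β ℤ.* y ≈ ⟦ x ⟧
      βy≈x = begin
        ⟦ x ⟧ ℤ.* t ℤ.* y      ≡⟨ ℤ.*-assoc ⟦ x ⟧ t y ⟩
        ⟦ x ⟧ ℤ.* (t ℤ.* y)    ≈⟨ *-congˡ ⟦ x ⟧ (proj₂ (invertible i)) ⟩
        ⟦ x ⟧ ℤ.* + 1          ≡⟨ ℤ.*-identityʳ ⟦ x ⟧ ⟩
        ⟦ x ⟧                  ∎

  nf₀-covers : ∀ {k} (M : Config p k) → ∃ λ u → SameOrbit p (nf₀ u) M
  nf₀-covers {zero}  M = tt , I , λ ()
  nf₀-covers {suc k} M with Product.≡-dec Fin._≟_ Fin._≟_ (M zero) 𝟎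
  ... | yes M₀≡𝟎 with nf₀-covers (tail M)
  ...   | u , S , h = inj₁ u , S , λ where
            zero    → trans (⊙-zero S) (sym M₀≡𝟎)
            (suc j) → h j
  nf₀-covers {suc k} M | no M₀≢𝟎 with e₁-orbit (M zero) M₀≢𝟎
  ... | S , S⊙e₁≡M₀ with nf₁-covers (λ j → S ⁻¹ ⊙ M (suc j))
  ...   | u , β , h = inj₂ u , S ∙ U β , λ where
            zero    → trans (⊙-∙ S (U β) e₁) (trans (cong (S ⊙_) (U-fixes-e₁ β)) S⊙e₁≡M₀)
            (suc j) → trans (⊙-∙ S (U β) (nf₁ u j)) (trans (cong (S ⊙_) (h j)) (⊙-⁻¹ S (M (suc j))))

  nf₁-separated : ∀ {k} S → S ⊙ e₁ ≡ e₁ → (u v : NF₁ k) → (∀ j → S ⊙ nf₁ u j ≡ nf₁ v j) → u ≡ v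
  nf₁-separated {zero}  S _ tt tt _ = refl
  nf₁-separated {suc k} S fix (inj₁ (x , u)) (inj₁ (_ , v)) h =
    cong inj₁ (cong₂ _,_ (cong proj₁ (trans (sym (fixes-axis x)) (h zero))) (nf₁-separated S fix u v (h ∘ suc)))
    where open Stabilizer S fix
  nf₁-separated {suc k} S fix (inj₁ (x , _)) (inj₂ _) h =
    ⊥-elim (Fin.0≢1+n (cong proj₂ (trans (sym (fixes-axis x)) (h zero))))
    where open Stabilizer S fix
  nf₁-separated {suc k} S fix (inj₂ (i , _)) (inj₁ _) h =
    ⊥-elim (Fin.0≢1+n (trans (sym (cong proj₂ (h zero))) (fixes-second (suc i))))
    where open Stabilizer S fix
  nf₁-separated {suc k} S fix (inj₂ (i , u)) (inj₂ (i′ , v)) h =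
    cong inj₂ (cong₂ _,_ i≡i′ (nf₂-injective u v (λ j → trans (sym (trivial b≈0 (nf₂ u j))) (h (suc j)))))
    where
      open Stabilizer S fix
      i≡i′ : i ≡ i′
      i≡i′ = Fin.suc-injective (trans (sym (fixes-second (suc i))) (cong proj₂ (h zero)))
      first : ∀ a b Y → b ℤ.* Y ≡ a ℤ.* + 0 ℤ.+ b ℤ.* Y
      first = solve-∀
      b≈0 : b ≈ + 0
      b≈0 = cancel-nonzero i (≈-trans (≈-reflexive (first a b ⟦ suc i ⟧)) (proj₁ (⊙≡⇒≈ S (zero , suc i) (h zero))))

  nf₀-separated : ∀ {k} S (u v : NF₀ k) → (∀ j → S ⊙ nf₀ u j ≡ nf₀ v j) → u ≡ v
  nf₀-separated {zero}  S tt tt _ = refl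
  nf₀-separated {suc k} S (inj₁ u) (inj₁ v) h = cong inj₁ (nf₀-separated S u v (h ∘ suc))
  nf₀-separated {suc k} S (inj₁ _) (inj₂ _) h =
    ⊥-elim (Fin.0≢1+n (cong proj₁ (trans (sym (⊙-zero S)) (h zero))))
  nf₀-separated {suc k} S (inj₂ _) (inj₁ _) h = ⊥-elim (first-column-nonzero S (h zero))
  nf₀-separated {suc k} S (inj₂ u) (inj₂ v) h = cong inj₂ (nf₁-separated S (h zero) u v (h ∘ suc))

  orbitCount : ∀ n → HasOrbitCount p n (#NF₀ n)
  orbitCount n = normalForms⇒hasOrbitCount nf₀ (enum₀ n) nf₀-covers (λ u v (S , h) → nf₀-separated S u v h)

theorem4 : (p n : ℕ) .{{_ : NonZero p}} → Prime p → 1 ≤ n →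
    Σ ℕ λ r → HasOrbitCount p n r
      × (r * (p ^ 2 ∸ 1) + p ^ (n ∸ 1) + p + 1
         ≡ p ^ (2 * n ∸ 1) + p ^ (n + 1) + p ^ 2)
theorem4 0 _ p-prime _ = ⊥-elim (¬prime[0] p-prime)
theorem4 1 _ p-prime _ = ⊥-elim (¬prime[1] p-prime)
theorem4 (suc (suc _)) zero _ ()
theorem4 (suc (suc q′)) (suc m) p-prime _ = #NF₀ (suc m) , orbitCount (suc m) , #NF₀-formula m
  where
    open NormalForms (suc q′)
    open Orbits q′ p-prime
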